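{- For every $n$, let $T(n)$ be the complete binary tree on $n$ vertices and let $D(n)$ be the digraph obtained from $T(n)$ by replacing each undirected edge $\{u,v\}$ by the two directed edges $(u,v)$ and $(v,u)$. Then $D(n)$ has zig-zag number at most $2$, while its directed path-width is $\Omega(\log n)$.
   Context: The complete binary tree on $n$ vertices is the binary tree in which every level except possibly the last is completely filled and all nodes of the last level are as far left as possible. A directed path decomposition of a digraph $G=(V,E)$ is a sequence $X_1,\dots,X_p\subseteq V$ with $\bigcup_j X_j=V$, $X_i\cap X_k\subseteq X_j$ whenever $i<j<k$, and, for every edge $(u,v)\in E$, indices $i\leq j$ with $u\in X_i$, $v\in X_j$; its width is the size of its largest set and the directed path-width is the minimum width of such a decomposition. For $V_1,V_2\subseteq V$, $E(V_1,V_2)$ is the set of edges with one endpoint in $V_1$ and the other in $V_2$. A linear ordering $(v_1,\dots,v_n)$ of $V$ is $z$-topological if every directed simple path $p=(V_p,E_p)$ satisfies $|E_p\cap E(\{v_1,\dots,v_i\},\{v_{i+1},\dots,v_n\})|\leq z$ for all $i$; the zig-zag number is the minimum such $z$. -}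

module Defs where

open import Data.Nat using (ℕ; zero; suc; _+_; _*_; _<_; _≤_; _<ᵇ_; _⊔_)
open import Data.Bool using (Bool; true; false; _xor_; if_then_else_)
open import Data.Fin using (Fin; toℕ; zero; suc)
open import Data.Fin.Subset using (Subset; _∈_; _∩_; _⊆_; ∣_∣)
open import Data.Fin.Permutation using (Permutation′; _⟨$⟩ˡ_)
open import Data.List using (List; []; _∷_)
open import Data.List.Relation.Unary.Linked using (Linked)
open import Data.List.Relation.Unary.Unique.Propositional using (Unique)
open import Data.Product using (Σ; _×_; ∃)
open import Data.Sum using (_⊎_)
open import Relation.Binary.PropositionalEquality using (_≡_)

Digraph : ℕ → Set₁
Digraph n = Fin n → Fin n → Set

-- Complete binary tree on n vertices, in heap (level-order) numbering:
-- vertex i has children 2i+1 and 2i+2 (when < n).  This is exactly the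
-- binary tree with all levels full except possibly the last, whose
-- vertices are as far left as possible.

Child : ∀ {n} → Fin n → Fin n → Set
Child u v = (toℕ v ≡ 2 * toℕ u + 1) ⊎ (toℕ v ≡ 2 * toℕ u + 2)

TreeAdj : ∀ {n} → Fin n → Fin n → Set
TreeAdj u v = Child u v ⊎ Child v u

D : (n : ℕ) → Digraph n
D n u v = TreeAdj u v

DirectedSimplePath : ∀ {n} → Digraph n → List (Fin n) → Set
DirectedSimplePath E vs = Linked E vs × Unique vs

-- For the ordering σ (v_{k+1} = σ ⟨$⟩ʳ k, 0-indexed position σ ⟨$⟩ˡ v),
-- InPrefix σ i v  holds iff v ∈ {v_1,…,v_i}.
inPrefix : ∀ {n} → Permutation′ n → ℕ → Fin n → Bool
inPrefix σ i v = toℕ (σ ⟨$⟩ˡ v) <ᵇ i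

crossings : ∀ {n} → Permutation′ n → ℕ → List (Fin n) → ℕ
crossings σ i []           = 0
crossings σ i (a ∷ [])     = 0
crossings σ i (a ∷ b ∷ vs) =
  (if inPrefix σ i a xor inPrefix σ i b then 1 else 0) + crossings σ i (b ∷ vs)

ZTopological : ∀ {n} → Digraph n → ℕ → Permutation′ n → Set
ZTopological {n} E z σ =
  ∀ (vs : List (Fin n)) → DirectedSimplePath E vs →
  ∀ (i : ℕ) → i ≤ n → crossings σ i vs ≤ z

ZigZagAtMost : ∀ {n} → Digraph n → ℕ → Set
ZigZagAtMost E z = ∃ λ σ → ZTopological E z σ

record DirectedPathDecomposition {n : ℕ} (E : Digraph n) : Set where
  field
    p     : ℕ
    X     : Fin p → Subset n
    cover : ∀ (v : Fin n) → ∃ λ j → v ∈ X j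
    interp : ∀ (i j k : Fin p) → toℕ i < toℕ j → toℕ j < toℕ k →
             (X i ∩ X k) ⊆ X j
    edges : ∀ (u v : Fin n) → E u v →
            Σ (Fin p) λ i → Σ (Fin p) λ j →
              (toℕ i ≤ toℕ j) × (u ∈ X i) × (v ∈ X j)

maxSize : ∀ {n} (p : ℕ) → (Fin p → Subset n) → ℕ
maxSize zero    X = 0
maxSize (suc p) X = ∣ X zero ∣ ⊔ maxSize p (λ j → X (suc j))

width : ∀ {n} {E : Digraph n} → DirectedPathDecomposition E → ℕ
width d = maxSize (DirectedPathDecomposition.p d) (DirectedPathDecomposition.X d)

DirPathWidthAtLeast : ∀ {n} → Digraph n → ℕ → Set
DirPathWidthAtLeast E w = ∀ (d : DirectedPathDecomposition E) → w ≤ width d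

module Submission where

-- Order the vertices in heap (level) order: vertex i has children
-- 2i+1 and 2i+2.  Parents are unique, so a simple path of the tree climbs for a
-- while and then only descends; in heap order it is a "valley".  Every prefix of
-- the order is closed under taking parents, so a valley enters a prefix at most
-- once and leaves it at most once: at most 2 crossings.
--
-- For a directed path decomposition of a symmetric digraph, the
-- bags between two bags meeting x and y each meet every walk from x to y.  Take
-- a complete subtree of depth h+2 rooted at u, with disjoint subtrees l, r (below
-- the left child of u) and s (the right child) of depth h.  By induction some
-- bag of each holds 1+⌊h/2⌋ of its vertices; of the three bags one lies between
-- the other two, and it meets the tree path through u joining the two outer
-- subtrees in a vertex outside its own subtree.  So a complete subtree of depth
-- h forces a bag of size 1+⌊h/2⌋, and T(n) has one of depth ⌊log₂ n⌋ − 1.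

open import Defs
open import Data.Nat using (ℕ; zero; suc; _+_; _*_; _^_; _∸_; _<_; _≤_; z≤n; s≤s; ⌊_/2⌋)
open import Data.Nat.Properties
open import Data.Nat.Tactic.RingSolver using (solve-∀)
open import Data.Nat.Logarithm using (⌊log₂_⌋; ⌊log₂⌊n/2⌋⌋≡⌊log₂n⌋∸1)
open import Data.Bool using (true; false; if_then_else_)
open import Data.Bool.Properties using (T-≡)
open import Data.Fin using (Fin; toℕ; fromℕ<; zero; suc)
open import Data.Fin.Properties using (toℕ-fromℕ<; toℕ-injective)
open import Data.Fin.Permutation using (Permutation′; _⟨$⟩ˡ_; id)
open import Data.Fin.Subset using (Subset; _∈_; _-_; ∣_∣)
open import Data.Fin.Subset.Properties using (x∈p∩q⁺; x∈p∧x≢y⇒x∈p-y; x∈p⇒∣p-x∣<∣p∣)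
open import Data.List using (List; []; _∷_; length)
open import Data.List.Relation.Unary.Linked using (Linked; []; [-]; _∷_)
open import Data.List.Relation.Unary.All as All using (All; []; _∷_)
open import Data.List.Relation.Unary.AllPairs using ([]; _∷_)
open import Data.List.Relation.Unary.Unique.Propositional using (Unique)
open import Data.Product using (_×_; ∃; _,_; proj₁; proj₂)
open import Data.Sum using (_⊎_; inj₁; inj₂; swap)
open import Function using (_∘_; Equivalence)
open import Relation.Binary.Definitions using (Symmetric)
open import Relation.Binary.Construct.Closure.ReflexiveTransitive using (Star; ε; _◅_; _◅◅_)
open import Relation.Nullary using (¬_; yes; no; contradiction)
open import Relation.Binary.PropositionalEquality

double-cancel : ∀ a c k → 2 * a + k ≡ 2 * c + k → a ≡ c
double-cancel a c k eq = *-cancelˡ-≡ a c 2 (+-cancelʳ-≡ k (2 * a) (2 * c) eq)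

left≢right : ∀ a c → 2 * a + 1 ≢ 2 * c + 2
left≢right a c eq = even≢odd (suc c) a (begin
  2 * suc c      ≡⟨ *-suc 2 c ⟩
  2 + 2 * c      ≡⟨ +-comm 2 (2 * c) ⟩
  2 * c + 2      ≡⟨ sym eq ⟩
  2 * a + 1      ≡⟨ +-comm (2 * a) 1 ⟩
  suc (2 * a)    ∎)
  where open ≡-Reasoning

parent-unique : ∀ {n} {a c x : Fin n} → Child a x → Child c x → a ≡ c
parent-unique {a = a} {c} (inj₁ p) (inj₁ q) = toℕ-injective (double-cancel (toℕ a) (toℕ c) 1 (trans (sym p) q))
parent-unique {a = a} {c} (inj₂ p) (inj₂ q) = toℕ-injective (double-cancel (toℕ a) (toℕ c) 2 (trans (sym p) q))
parent-unique {a = a} {c} (inj₁ p) (inj₂ q) = contradiction (trans (sym p) q) (left≢right (toℕ a) (toℕ c))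
parent-unique {a = a} {c} (inj₂ p) (inj₁ q) = contradiction (trans (sym q) p) (left≢right (toℕ c) (toℕ a))

child< : ∀ {n} {u v : Fin n} → Child u v → toℕ u < toℕ v
child< {u = u} ch = ≤-<-trans (m≤n*m (toℕ u) 2) (<-≤-trans (m<m+n (2 * toℕ u) (s≤s z≤n)) (bound ch))
  where
  bound : ∀ {v} → Child u v → 2 * toℕ u + 1 ≤ toℕ v
  bound (inj₁ p) = ≤-reflexive (sym p)
  bound (inj₂ p) = ≤-trans (+-monoʳ-≤ (2 * toℕ u) (n≤1+n 1)) (≤-reflexive (sym p))

Ascending : ∀ {n} → (Fin n → ℕ) → List (Fin n) → Set
Ascending rank = Linked (λ a b → rank a < rank b)

data Valley {n} (rank : Fin n → ℕ) : List (Fin n) → Set where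
  ascending : ∀ {vs} → Ascending rank vs → Valley rank vs
  descend   : ∀ {a b vs} → rank b < rank a → Valley rank (b ∷ vs) → Valley rank (a ∷ b ∷ vs)

-- Once a simple path of the tree steps down to a child it can never step up
-- again: the only way up is back to the parent just left.
downward-paths-ascend : ∀ {n} {a b : Fin n} {vs} → Child a b → Linked TreeAdj (b ∷ vs) →
  Unique (a ∷ b ∷ vs) → Ascending toℕ (a ∷ b ∷ vs)
downward-paths-ascend ch [-] _ = child< ch ∷ [-]
downward-paths-ascend ch (inj₁ ch′ ∷ path) ((_ ∷ _) ∷ distinct) =
  child< ch ∷ downward-paths-ascend ch′ path distinct
downward-paths-ascend ch (inj₂ ch′ ∷ _) ((_ ∷ a≢c ∷ _) ∷ _) = contradiction (parent-unique ch ch′) a≢c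

simple-path-valley : ∀ {n} (vs : List (Fin n)) → DirectedSimplePath (D n) vs → Valley toℕ vs
simple-path-valley []           _                          = ascending []
simple-path-valley (a ∷ [])     _                          = ascending [-]
simple-path-valley (a ∷ b ∷ vs) (inj₁ ch ∷ path , distinct) = ascending (downward-paths-ascend ch path distinct)
simple-path-valley (a ∷ b ∷ vs) (inj₂ ch ∷ path , _ ∷ distinct) =
  descend (child< ch) (simple-path-valley (b ∷ vs) (path , distinct))

position : ∀ {n} → Permutation′ n → Fin n → ℕ
position σ v = toℕ (σ ⟨$⟩ˡ v)

module _ {n : ℕ} (σ : Permutation′ n) (i : ℕ) where

  prefix-closed : ∀ {a b} → position σ a < position σ b → inPrefix σ i b ≡ true → inPrefix σ i a ≡ true
  prefix-closed a<b b∈ = Equivalence.to T-≡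
    (<⇒<ᵇ (<-trans a<b (<ᵇ⇒< (position σ _) i (Equivalence.from T-≡ b∈))))

  ascending-crossings : ∀ {a vs} → Ascending (position σ) (a ∷ vs) →
    crossings σ i (a ∷ vs) ≤ (if inPrefix σ i a then 1 else 0)
  ascending-crossings {vs = []} _ = z≤n
  ascending-crossings {a} {b ∷ vs} (a<b ∷ asc)
    with inPrefix σ i a in a∈ | inPrefix σ i b in b∈ | ascending-crossings asc
  ... | true  | true  | ih = ih
  ... | true  | false | ih = s≤s ih
  ... | false | true  | _  = contradiction (trans (sym a∈) (prefix-closed a<b b∈)) λ ()
  ... | false | false | ih = ih

  valley-crossings : ∀ {a vs} → Valley (position σ) (a ∷ vs) →
    crossings σ i (a ∷ vs) ≤ (if inPrefix σ i a then 1 else 2)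
  valley-crossings {a} (ascending asc) with inPrefix σ i a | ascending-crossings asc
  ... | true  | bound = bound
  ... | false | bound = ≤-trans bound z≤n
  valley-crossings {a} {b ∷ vs} (descend b<a valley)
    with inPrefix σ i a in a∈ | inPrefix σ i b in b∈ | valley-crossings valley
  ... | true  | true  | ih = ih
  ... | true  | false | _  = contradiction (trans (sym b∈) (prefix-closed b<a a∈)) λ ()
  ... | false | true  | ih = s≤s ih
  ... | false | false | ih = ih

  valley-crossings≤2 : ∀ {vs} → Valley (position σ) vs → crossings σ i vs ≤ 2
  valley-crossings≤2 {[]}    _      = z≤n
  valley-crossings≤2 {a ∷ _} valley with inPrefix σ i a | valley-crossings valley
  ... | true  | bound = ≤-trans bound (n≤1+n 1)
  ... | false | bound = bound

heap-order-2-topological : ∀ n → ZTopological (D n) 2 id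
heap-order-2-topological n vs path i _ = valley-crossings≤2 id i (simple-path-valley vs path)

Parent : ∀ {n} → Fin n → Fin n → Set
Parent x w = Child w x

Desc : ∀ {n} → Fin n → Fin n → Set
Desc w x = Star Parent x w

desc-trans : ∀ {n} {a b c : Fin n} → Desc a b → Desc b c → Desc a c
desc-trans a-b b-c = b-c ◅◅ a-b

child-desc : ∀ {n} {w x : Fin n} → Child w x → Desc w x
child-desc ch = ch ◅ ε

desc≤ : ∀ {n} {w x : Fin n} → Desc w x → toℕ w ≤ toℕ x
desc≤ ε          = ≤-refl
desc≤ (ch ◅ up) = ≤-trans (desc≤ up) (<⇒≤ (child< ch))

-- Two ancestors of the same vertex are comparable, since parents are unique.
ancestors-comparable : ∀ {n} {p q x : Fin n} → Desc p x → Desc q x → Desc p q ⊎ Desc q p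
ancestors-comparable ε           q-x        = inj₂ q-x
ancestors-comparable p-x@(_ ◅ _) ε          = inj₁ p-x
ancestors-comparable (_◅_ {j = a} s up) (_◅_ {j = b} s′ up′)
  with parent-unique {a = a} {c = b} s s′
... | refl = ancestors-comparable up up′

Disjoint : ∀ {n} → Fin n → Fin n → Set
Disjoint {n} a b = ∀ {x : Fin n} → Desc a x → ¬ Desc b x

disjoint-sym : ∀ {n} {a b : Fin n} → Disjoint a b → Disjoint b a
disjoint-sym a∥b b-x a-x = a∥b a-x b-x

disjoint-below : ∀ {n} {a a′ b : Fin n} → Desc a a′ → Disjoint a b → Disjoint a′ b
disjoint-below a-a′ a∥b a′-x = a∥b (desc-trans a-a′ a′-x)

-- A vertex never lies strictly below its sibling a: their common parent u would
-- then lie in the subtree of a, although u has a smaller index than a.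
sibling-not-below : ∀ {n} {u a b : Fin n} → Child u a → Child u b → Desc a b → a ≡ b
sibling-not-below _ _ ε = refl
sibling-not-below {u = u} ua ub (_◅_ {j = p} s up) with parent-unique {a = p} {c = u} s ub
... | refl = contradiction (desc≤ up) (<⇒≱ (child< ua))

siblings-disjoint : ∀ {n} {u a b : Fin n} → Child u a → Child u b → a ≢ b → Disjoint a b
siblings-disjoint {u = u} ua ub a≢b a-x b-x with ancestors-comparable a-x b-x
... | inj₁ a-b = a≢b (sibling-not-below {u = u} ua ub a-b)
... | inj₂ b-a = a≢b (sym (sibling-not-below {u = u} ub ua b-a))

-- The subtree of depth h rooted at w is complete in T(n): its last vertex,
-- of index (w + 2)·2ʰ − 2, exists.
Complete : ∀ {n} → ℕ → Fin n → Set
Complete {n} h w = (toℕ w + 2) * 2 ^ h ≤ suc n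

complete-weaken : ∀ {n} h (w : Fin n) → Complete (suc h) w → Complete h w
complete-weaken h w c = ≤-trans (*-monoʳ-≤ (toℕ w + 2) (m≤m+n (2 ^ h) _)) c

record Children {n} (h : ℕ) (w : Fin n) : Set where
  field
    left right     : Fin n
    left-child     : Child w left
    right-child    : Child w right
    distinct       : left ≢ right
    left-complete  : Complete h left
    right-complete : Complete h right

complete-children : ∀ {n} h (w : Fin n) → Complete (suc h) w → Children h w
complete-children {n} h w c = record
  { left           = left
  ; right          = right
  ; left-child     = inj₁ is-left
  ; right-child    = inj₂ is-right
  ; distinct       = λ eq → left≢right W W (trans (sym is-left) (trans (cong toℕ eq) is-right))
  ; left-complete  = ≤-trans left-size right-complete
  ; right-complete = right-complete
  }
  where
  W K : ℕ
  W = toℕ w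
  K = 2 ^ h

  right-end : ∀ W → suc (suc (2 * W + 2)) ≡ (W + 2) * 2
  right-end = solve-∀

  right-subtree : ∀ W K → (2 * W + 2 + 2) * K ≡ (W + 2) * (2 * K)
  right-subtree = solve-∀

  right<n : 2 * W + 2 < n
  right<n = ≤-pred (begin
    suc (suc (2 * W + 2)) ≡⟨ right-end W ⟩
    (W + 2) * 2           ≤⟨ *-monoʳ-≤ (W + 2) (*-monoʳ-≤ 2 (m^n>0 2 h)) ⟩
    (W + 2) * (2 * K)     ≤⟨ c ⟩
    suc n                 ∎)
    where open ≤-Reasoning

  left right : Fin n
  left  = fromℕ< (≤-<-trans (+-monoʳ-≤ (2 * W) (n≤1+n 1)) right<n)
  right = fromℕ< right<n

  is-left : toℕ left ≡ 2 * W + 1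
  is-left = toℕ-fromℕ< _
  is-right : toℕ right ≡ 2 * W + 2
  is-right = toℕ-fromℕ< right<n

  right-complete : Complete h right
  right-complete = begin
    (toℕ right + 2) * K ≡⟨ cong (λ x → (x + 2) * K) is-right ⟩
    (2 * W + 2 + 2) * K ≡⟨ right-subtree W K ⟩
    (W + 2) * (2 * K)   ≤⟨ c ⟩
    suc n               ∎
    where open ≤-Reasoning

  left-size : (toℕ left + 2) * K ≤ (toℕ right + 2) * K
  left-size = *-monoˡ-≤ K (+-monoˡ-≤ 2 (begin
    toℕ left      ≡⟨ is-left ⟩
    2 * W + 1     ≤⟨ +-monoʳ-≤ (2 * W) (n≤1+n 1) ⟩
    2 * W + 2     ≡⟨ sym is-right ⟩
    toℕ right     ∎))
    where open ≤-Reasoning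

Between : ℕ → ℕ → ℕ → Set
Between x y z = (x ≤ y × y ≤ z) ⊎ (z ≤ y × y ≤ x)

median : ∀ a b c → Between b a c ⊎ Between a b c ⊎ Between a c b
median a b c with ≤-total a b | ≤-total b c | ≤-total a c
... | inj₁ a≤b | inj₁ b≤c | _        = inj₂ (inj₁ (inj₁ (a≤b , b≤c)))
... | inj₁ a≤b | inj₂ c≤b | inj₁ a≤c = inj₂ (inj₂ (inj₁ (a≤c , c≤b)))
... | inj₁ a≤b | inj₂ c≤b | inj₂ c≤a = inj₁ (inj₂ (c≤a , a≤b))
... | inj₂ b≤a | inj₂ c≤b | _        = inj₂ (inj₁ (inj₂ (c≤b , b≤a)))
... | inj₂ b≤a | inj₁ b≤c | inj₁ a≤c = inj₁ (inj₁ (b≤a , a≤c))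
... | inj₂ b≤a | inj₁ b≤c | inj₂ c≤a = inj₂ (inj₂ (inj₂ (b≤c , c≤a)))

distinct-members≤size : ∀ {k} (P : Subset k) (xs : List (Fin k)) → Unique xs → All (_∈ P) xs →
  length xs ≤ ∣ P ∣
distinct-members≤size P []       _              _          = z≤n
distinct-members≤size P (x ∷ xs) (x∉xs ∷ dist) (x∈P ∷ xs∈P) =
  ≤-trans (s≤s (distinct-members≤size (P - x) xs dist (remove x∉xs xs∈P))) (x∈p⇒∣p-x∣<∣p∣ x∈P)
  where
  remove : ∀ {ys} → All (x ≢_) ys → All (_∈ P) ys → All (_∈ P - x) ys
  remove []             []           = []
  remove (x≢y ∷ x≢ys) (y∈P ∷ ys∈P) = x∈p∧x≢y⇒x∈p-y y∈P (x≢y ∘ sym) ∷ remove x≢ys ys∈P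

size≤maxSize : ∀ {k} q (Y : Fin q → Subset k) t → ∣ Y t ∣ ≤ maxSize q Y
size≤maxSize (suc q) Y zero    = m≤m⊔n _ _
size≤maxSize (suc q) Y (suc t) = ≤-trans (size≤maxSize q (λ j → Y (suc j)) t) (m≤n⊔m _ _)

module Separation {n : ℕ} {E : Digraph n} (d : DirectedPathDecomposition E) where
  open DirectedPathDecomposition d

  Before After : Fin p → Fin n → Set
  Before t v = ∃ λ a → toℕ a ≤ toℕ t × v ∈ X a
  After  t v = ∃ λ b → toℕ t ≤ toℕ b × v ∈ X b

  Opposite : Fin p → Fin n → Fin n → Set
  Opposite t a b = (Before t a × After t b) ⊎ (After t a × Before t b)

  opposite-sym : ∀ {t a b} → Opposite t a b → Opposite t b a
  opposite-sym (inj₁ (a≤ , ≤b)) = inj₂ (≤b , a≤)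
  opposite-sym (inj₂ (≤a , b≤)) = inj₁ (b≤ , ≤a)

  bags-opposite : ∀ {t a b x y} → x ∈ X a → y ∈ X b → Between (toℕ a) (toℕ t) (toℕ b) →
    Opposite t x y
  bags-opposite x∈ y∈ (inj₁ (a≤t , t≤b)) = inj₁ ((_ , a≤t , x∈) , (_ , t≤b , y∈))
  bags-opposite x∈ y∈ (inj₂ (b≤t , t≤a)) = inj₂ ((_ , t≤a , x∈) , (_ , b≤t , y∈))

  bag-interval : ∀ {v a b t} → v ∈ X a → v ∈ X b → toℕ a ≤ toℕ t → toℕ t ≤ toℕ b → v ∈ X t
  bag-interval {v} {a} {b} {t} v∈a v∈b a≤t t≤b with m≤n⇒m<n∨m≡n a≤t | m≤n⇒m<n∨m≡n t≤b
  ... | inj₂ a≡t | _        = subst (λ s → v ∈ X s) (toℕ-injective a≡t) v∈a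
  ... | inj₁ _   | inj₂ t≡b = subst (λ s → v ∈ X s) (sym (toℕ-injective t≡b)) v∈b
  ... | inj₁ a<t | inj₁ t<b = interp a t b a<t t<b (x∈p∩q⁺ (v∈a , v∈b))

  straddle : ∀ {t v} → Before t v → After t v → v ∈ X t
  straddle (_ , a≤t , v∈a) (_ , t≤b , v∈b) = bag-interval v∈a v∈b a≤t t≤b

  before-or-after : ∀ t v → Before t v ⊎ After t v
  before-or-after t v with cover v
  ... | j , v∈j with toℕ j ≤? toℕ t
  ...   | yes j≤t = inj₁ (j , j≤t , v∈j)
  ...   | no  j≰t = inj₂ (j , <⇒≤ (≰⇒> j≰t) , v∈j)

  opposite-split : ∀ {t a b} → Opposite t a b → ∀ c → Opposite t a c ⊎ Opposite t c b
  opposite-split {t} (inj₁ (a≤ , ≤b)) c with before-or-after t c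
  ... | inj₁ c≤ = inj₂ (inj₁ (c≤ , ≤b))
  ... | inj₂ ≤c = inj₁ (inj₁ (a≤ , ≤c))
  opposite-split {t} (inj₂ (≤a , b≤)) c with before-or-after t c
  ... | inj₁ c≤ = inj₁ (inj₂ (≤a , c≤))
  ... | inj₂ ≤c = inj₂ (inj₂ (≤c , b≤))

  edge-meets-bag : ∀ {t w v} → E w v → After t w → Before t v → w ∈ X t ⊎ v ∈ X t
  edge-meets-bag {t} {w} {v} e (_ , t≤b , w∈b) (_ , a≤t , v∈a) with edges w v e
  ... | i , j , i≤j , w∈i , v∈j with toℕ t ≤? toℕ j
  ...   | yes t≤j = inj₂ (bag-interval v∈a v∈j a≤t t≤j)
  ...   | no  t≰j = inj₁ (bag-interval w∈i w∈b (≤-trans i≤j (<⇒≤ (≰⇒> t≰j))) t≤b)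

  symmetric-edge-meets-bag : Symmetric E → ∀ {t a b} → E a b → Opposite t a b → a ∈ X t ⊎ b ∈ X t
  symmetric-edge-meets-bag sym-E e (inj₁ (a≤ , ≤b)) = swap (edge-meets-bag (sym-E e) ≤b a≤)
  symmetric-edge-meets-bag sym-E e (inj₂ (≤a , b≤)) = edge-meets-bag e ≤a b≤

  walk-meets-bag : ∀ {R : Digraph n} → Symmetric E → (∀ {a b} → R a b → E a b) →
    ∀ {t a b} → Star R a b → Opposite t a b →
    ∃ λ z → z ∈ X t × Star R a z × Star R z b
  walk-meets-bag sym-E R⊆E {a = a} ε (inj₁ (a≤ , ≤a)) = a , straddle a≤ ≤a , ε , ε
  walk-meets-bag sym-E R⊆E {a = a} ε (inj₂ (≤a , a≤)) = a , straddle a≤ ≤a , ε , ε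
  walk-meets-bag sym-E R⊆E (_◅_ {j = a′} r walk) opp with opposite-split opp a′
  ... | inj₂ opp′ with walk-meets-bag sym-E R⊆E walk opp′
  ...   | z , z∈ , a′-z , z-b = z , z∈ , r ◅ a′-z , z-b
  walk-meets-bag sym-E R⊆E {a = a} (_◅_ {j = a′} r walk) opp | inj₁ opp′
    with symmetric-edge-meets-bag sym-E (R⊆E r) opp′
  ... | inj₁ a∈  = a  , a∈  , ε , r ◅ walk
  ... | inj₂ a′∈ = a′ , a′∈ , r ◅ ε , walk

D-symmetric : ∀ {n} → Symmetric (D n)
D-symmetric = swap

module SubtreeBags {n : ℕ} (d : DirectedPathDecomposition (D n)) where
  open DirectedPathDecomposition d
  open Separation d

  record Crowded (t : Fin p) (w : Fin n) (k : ℕ) : Set where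
    constructor crowded
    field
      vertices : List (Fin n)
      count    : length vertices ≡ k
      distinct : Unique vertices
      inside   : All (λ x → x ∈ X t × Desc w x) vertices

  crowded≤width : ∀ {t w k} → Crowded t w k → k ≤ width d
  crowded≤width {t} (crowded xs refl dist inside) =
    ≤-trans (distinct-members≤size (X t) xs dist (All.map proj₁ inside)) (size≤maxSize p X t)

  singleton-bag : ∀ w → ∃ λ t → Crowded t w 1
  singleton-bag w with cover w
  ... | t , w∈t = t , crowded (w ∷ []) refl ([] ∷ []) ((w∈t , ε) ∷ [])

  some-vertex : ∀ {t w k} → Crowded t w (suc k) → ∃ λ x → x ∈ X t × Desc w x
  some-vertex (crowded (x ∷ _) _ _ (x∈ ∷ _)) = x , x∈

  crowded-extend : ∀ {t u M z k} → Desc u M → Crowded t M k → z ∈ X t → Desc u z → ¬ Desc M z →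
    Crowded t u (suc k)
  crowded-extend {t} {u} {M} {z} u-M (crowded xs count dist inside) z∈ u-z M↛z =
    crowded (z ∷ xs) (cong suc count) (All.map fresh inside ∷ dist)
      ((z∈ , u-z) ∷ All.map (λ (x∈ , M-x) → x∈ , desc-trans u-M M-x) inside)
    where
    fresh : ∀ {x} → x ∈ X t × Desc M x → z ≢ x
    fresh (_ , M-x) refl = M↛z M-x

  -- If t separates two vertices of the subtree of u that avoid the subtree of
  -- M ⊆ subtree(u), then X t holds a vertex of subtree(u) outside subtree(M):
  -- the tree path between them runs through u and avoids subtree(M).
  bag-escapes-subtree : ∀ {t u M x y} → Desc u x → Desc u y → ¬ Desc M x → ¬ Desc M y →
    Opposite t x y → ∃ λ z → z ∈ X t × Desc u z × ¬ Desc M z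
  bag-escapes-subtree {u = u} u-x u-y M↛x M↛y opp with opposite-split opp u
  ... | inj₁ x-vs-u with walk-meets-bag D-symmetric inj₂ u-x x-vs-u
  ...   | z , z∈ , z-x , u-z = z , z∈ , u-z , λ M-z → M↛x (desc-trans M-z z-x)
  bag-escapes-subtree {u = u} u-x u-y M↛x M↛y opp | inj₂ u-vs-y
    with walk-meets-bag D-symmetric inj₂ u-y (opposite-sym u-vs-y)
  ... | z , z∈ , z-y , u-z = z , z∈ , u-z , λ M-z → M↛y (desc-trans M-z z-y)

  middle-bag-grows : ∀ {u P M Q tP tM tQ i j k} → Desc u P → Desc u M → Desc u Q →
    Disjoint P M → Disjoint Q M →
    Crowded tP P (suc i) → Crowded tM M k → Crowded tQ Q (suc j) →
    Between (toℕ tP) (toℕ tM) (toℕ tQ) → Crowded tM u (suc k)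
  middle-bag-grows u-P u-M u-Q P∥M Q∥M bagP bagM bagQ between
    with some-vertex bagP | some-vertex bagQ
  ... | x , x∈ , P-x | y , y∈ , Q-y
    with bag-escapes-subtree (desc-trans u-P P-x) (desc-trans u-Q Q-y) (P∥M P-x) (Q∥M Q-y)
           (bags-opposite x∈ y∈ between)
  ... | z , z∈ , u-z , M↛z = crowded-extend u-M bagM z∈ u-z M↛z

  middle-of-three : ∀ {u l r s k} → Desc u l → Desc u r → Desc u s →
    Disjoint l r → Disjoint l s → Disjoint r s →
    (∃ λ t → Crowded t l (suc k)) → (∃ λ t → Crowded t r (suc k)) → (∃ λ t → Crowded t s (suc k)) →
    ∃ λ t → Crowded t u (suc (suc k))
  middle-of-three u-l u-r u-s l∥r l∥s r∥s (tl , bag-l) (tr , bag-r) (ts , bag-s)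
    with median (toℕ tl) (toℕ tr) (toℕ ts)
  ... | inj₁ l-middle =
    tl , middle-bag-grows u-r u-l u-s (disjoint-sym l∥r) (disjoint-sym l∥s) bag-r bag-l bag-s l-middle
  ... | inj₂ (inj₁ r-middle) =
    tr , middle-bag-grows u-l u-r u-s l∥r (disjoint-sym r∥s) bag-l bag-r bag-s r-middle
  ... | inj₂ (inj₂ s-middle) =
    ts , middle-bag-grows u-l u-s u-r l∥s r∥s bag-l bag-s bag-r s-middle

  complete-subtree-bag : ∀ h (w : Fin n) → Complete h w → ∃ λ t → Crowded t w (suc ⌊ h /2⌋)
  complete-subtree-bag zero          w _ = singleton-bag w
  complete-subtree-bag (suc zero)    w _ = singleton-bag w
  complete-subtree-bag (suc (suc h)) u u-complete =
    middle-of-three u-l u-r u-s l∥r l∥s r∥s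
      (complete-subtree-bag h l l-complete) (complete-subtree-bag h r r-complete)
      (complete-subtree-bag h s (complete-weaken h s s-complete))
    where
    open Children (complete-children (suc h) u u-complete) using () renaming
      (left to c; right to s; left-child to u→c; right-child to u→s; distinct to c≢s;
       left-complete to c-complete; right-complete to s-complete)
    open Children (complete-children h c c-complete) using () renaming
      (left to l; right to r; left-child to c→l; right-child to c→r; distinct to l≢r;
       left-complete to l-complete; right-complete to r-complete)

    u-l : Desc u l
    u-l = desc-trans (child-desc u→c) (child-desc c→l)
    u-r : Desc u r
    u-r = desc-trans (child-desc u→c) (child-desc c→r)
    u-s : Desc u s
    u-s = child-desc u→s

    c∥s : Disjoint c s
    c∥s = siblings-disjoint {u = u} u→c u→s c≢s
    l∥r : Disjoint l r
    l∥r = siblings-disjoint {u = c} c→l c→r l≢r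
    l∥s : Disjoint l s
    l∥s = disjoint-below (child-desc {w = c} c→l) c∥s
    r∥s : Disjoint r s
    r∥s = disjoint-below (child-desc {w = c} c→r) c∥s

half-bounds : ∀ h → 2 * ⌊ h /2⌋ ≤ h × h ≤ suc (2 * ⌊ h /2⌋)
half-bounds zero          = z≤n , z≤n
half-bounds (suc zero)    = z≤n , s≤s z≤n
half-bounds (suc (suc h)) with half-bounds h
... | lower , upper = subst (_≤ suc (suc h)) (sym (*-suc 2 ⌊ h /2⌋)) (s≤s (s≤s lower))
                    , subst (λ m → suc (suc h) ≤ suc m) (sym (*-suc 2 ⌊ h /2⌋)) (s≤s (s≤s upper))

2^⌊log₂⌋≤ : ∀ L k → ⌊log₂ suc k ⌋ ≡ L → 2 ^ L ≤ suc k
2^⌊log₂⌋≤ zero    k       _  = s≤s z≤n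
2^⌊log₂⌋≤ (suc L) (suc k) eq = begin
  2 * 2 ^ L         ≤⟨ *-monoʳ-≤ 2 (2^⌊log₂⌋≤ L ⌊ k /2⌋ half-log) ⟩
  2 * suc ⌊ k /2⌋   ≡⟨ *-suc 2 ⌊ k /2⌋ ⟩
  2 + 2 * ⌊ k /2⌋   ≤⟨ +-monoʳ-≤ 2 (proj₁ (half-bounds k)) ⟩
  suc (suc k)       ∎
  where
  open ≤-Reasoning
  half-log : ⌊log₂ suc ⌊ k /2⌋ ⌋ ≡ L
  half-log = trans (⌊log₂⌊n/2⌋⌋≡⌊log₂n⌋∸1 (suc (suc k))) (cong (_∸ 1) eq)

-- Every directed path decomposition of D(n), n ≥ 1, has width ≥ ⌊log₂ n⌋ / 2:
-- T(n) contains a complete subtree of depth ⌊log₂ n⌋ − 1 at its root.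
log-width-bound : ∀ k (d : DirectedPathDecomposition (D (suc k))) → ⌊log₂ suc k ⌋ ≤ 2 * width d
log-width-bound k d with ⌊log₂ suc k ⌋ in log-eq
... | zero  = z≤n
... | suc L = begin
  suc L                   ≤⟨ s≤s (proj₂ (half-bounds L)) ⟩
  suc (suc (2 * ⌊ L /2⌋)) ≡⟨ sym (*-suc 2 ⌊ L /2⌋) ⟩
  2 * suc ⌊ L /2⌋         ≤⟨ *-monoʳ-≤ 2 (crowded≤width (proj₂ root-bag)) ⟩
  2 * width d             ∎
  where
  open ≤-Reasoning
  open SubtreeBags d
  root-complete : Complete L zero
  root-complete = ≤-trans (2^⌊log₂⌋≤ (suc L) k log-eq) (n≤1+n _)
  root-bag : ∃ λ t → Crowded t zero (suc ⌊ L /2⌋)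
  root-bag = complete-subtree-bag L zero root-complete

lemma4 : ((n : ℕ) → ZigZagAtMost (D n) 2)
       × (∃ λ c → ∃ λ N → ∀ (n : ℕ) → N ≤ n →
            ∀ (d : DirectedPathDecomposition (D n)) → ⌊log₂ n ⌋ ≤ c * width d)
lemma4 = (λ n → id , heap-order-2-topological n)
       , 2 , 1 , λ { (suc k) _ d → log-width-bound k d }
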